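{- Let $q$ be an odd prime power and consider the directed graph $\mathcal{J}_{\mathbb{F}_q}$ defined below, and a connected component of it (connected component of the underlying undirected graph). Then: (1) If some edge in the component connects two square vertices, then all vertices in the component are square vertices. (2) If some edge in the component connects two non-square vertices, then all vertices in the component are non-square vertices. (3) If some edge in the component connects a square vertex and a non-square vertex, then in the component square and non-square vertices alternate, i.e., there is no edge in this component connecting two square vertices or two non-square vertices.
   Context: $\mathbb{F}_q$ is the finite field with $q$ elements, $q$ odd. $\phi_q\colon \mathbb{F}_q^\times\to\{\pm1\}$ is the quadratic character: $\phi_q(a)=1$ if $a$ is a square in $\mathbb{F}_q^\times$ and $-1$ otherwise. The directed graph $\mathcal{J}_{\mathbb{F}_q}=(V,E)$ has vertex set $V=\{(a,b)\in(\mathbb{F}_q^\times)^2 : \phi_q(ab)=1,\ a\neq \pm b\}$, and for $(a,b),(c,d)\in V$ there is an edge $(a,b)\to(c,d)$ if and only if $c=\frac{a+b}{2}$ and $d^2=ab$. A vertex $(a,b)\in V$ is a square vertex if both $a$ and $b$ are squares in $\mathbb{F}_q^\times$; all other vertices are non-square vertices. -}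

module Defs where

open import Data.Nat using (ℕ)
open import Data.Fin using (Fin)
open import Data.Product using (Σ; ∃; _×_; _,_; proj₁; proj₂)
open import Relation.Binary.PropositionalEquality using (_≡_; _≢_)
open import Relation.Nullary using (¬_)
open import Algebra.Structures using (IsCommutativeRing)
open import Function.Bundles using (_↔_)
open import Relation.Binary.Construct.Closure.Equivalence using (EqClosure)

record Field : Set₁ where
  infixl 6 _+_
  infixl 7 _*_
  infix  8 -_
  infix  9 _⁻¹
  field
    Carrier : Set
    _+_ _*_ : Carrier → Carrier → Carrier
    -_      : Carrier → Carrier
    0# 1#   : Carrier
    _⁻¹     : Carrier → Carrier
    isCommutativeRing : IsCommutativeRing _≡_ _+_ _*_ -_ 0# 1#
    0≢1     : 0# ≢ 1#
    ⁻¹-inverse : ∀ x → x ≢ 0# → x * (x ⁻¹) ≡ 1#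

record FiniteField (q : ℕ) : Set₁ where
  field
    field' : Field
  open Field field' public
  field
    enumeration : Carrier ↔ Fin q

Odd : ℕ → Set
Odd q = ∃ λ k → q ≡ Data.Nat.suc (2 Data.Nat.* k)

module Jgraph {q : ℕ} (F : FiniteField q) where
  open FiniteField F

  two : Carrier
  two = 1# + 1#

  -- a is a square in F (for a ≠ 0 this means a is a square in F^×, i.e. φ_q(a) = 1)
  IsSquare : Carrier → Set
  IsSquare a = ∃ λ b → b * b ≡ a

  IsVertex : Carrier × Carrier → Set
  IsVertex (a , b) = (a ≢ 0#) × (b ≢ 0#) × IsSquare (a * b) × (a ≢ b) × (a ≢ - b)

  Vertex : Set
  Vertex = Σ (Carrier × Carrier) IsVertex

  Edge : Vertex → Vertex → Set
  Edge ((a , b) , _) ((c , d) , _) = (c ≡ (a + b) * (two ⁻¹)) × (d * d ≡ a * b)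

  SquareVertex : Vertex → Set
  SquareVertex ((a , b) , _) = IsSquare a × IsSquare b

  NonSquareVertex : Vertex → Set
  NonSquareVertex v = ¬ SquareVertex v

  Connected : Vertex → Vertex → Set
  Connected = EqClosure Edge

-- For a vertex (a, b) put κ(a, b) = a (a + b)/2. Along an edge (a, b) → (c, d) we have
-- c = (a + b)/2, so κ(a, b) = a c, and d² = ab gives κ(a, b) κ(c, d) = (c (a + d)/2)².
-- So the square class of κ is constant on a connected component, and with it the class k of
-- the product of the first coordinates of any two adjacent vertices. The first coordinates
-- in a component therefore lie in the classes [a] and k[a], adjacent vertices lying in
-- different classes exactly when k is not a square; and (a, b) is a square vertex exactly
-- when a is a square, since ab is.
module Submission where

open import Defs
open import Data.Nat using (ℕ)
open import Data.Product using (_×_)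
open import Data.Sum using (_⊎_)
open import Relation.Nullary using (¬_)

open import Algebra.Bundles using (CommutativeRing)
open import Algebra.Structures using (IsCommutativeRing)
import Algebra.Properties.Ring as RingProperties
import Algebra.Solver.Ring.NaturalCoefficients as NaturalCoefficientsSolver
open import Data.Empty using (⊥-elim)
open import Data.Fin using (Fin; punchOut)
open import Data.Fin.Properties using (any?; punchOut-injective; <⇒notInjective; inj⇒≟)
open import Data.Maybe using (nothing)
open import Data.Nat.Properties using (n<1+n)
open import Data.Product using (_,_; proj₁; proj₂)
open import Data.Sum using (inj₁; inj₂; [_,_]′)
open import Function.Base using (_∘_)
open import Function.Bundles using (_↔_; Inverse; Injection)
open import Function.Definitions using (Injective; StrictlySurjective)
open import Function.Properties.Inverse using (↔⇒↣)
open import Relation.Binary.Construct.Closure.ReflexiveTransitive using (ε; _◅_)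
open import Relation.Binary.Construct.Closure.Symmetric using (SymClosure; fwd; bwd)
open import Relation.Binary.Definitions using (DecidableEquality)
open import Relation.Binary.PropositionalEquality
open import Relation.Nullary using (yes; no)

Fin-injective⇒strictlySurjective : ∀ {n} (f : Fin n → Fin n) →
  Injective _≡_ _≡_ f → StrictlySurjective _≡_ f
Fin-injective⇒strictlySurjective {ℕ.zero}  f f-inj ()
Fin-injective⇒strictlySurjective {ℕ.suc n} f f-inj y with any? (λ x → f x Data.Fin.≟ y)
... | yes hit = hit
... | no miss = ⊥-elim (<⇒notInjective (n<1+n n) punchOut∘f-injective)
  where
  y≢f : ∀ x → y ≢ f x
  y≢f x y≡fx = miss (x , sym y≡fx)

  punchOut∘f : Fin (ℕ.suc n) → Fin n
  punchOut∘f x = punchOut (y≢f x)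

  punchOut∘f-injective : Injective _≡_ _≡_ punchOut∘f
  punchOut∘f-injective {x} {x′} = f-inj ∘ punchOut-injective (y≢f x) (y≢f x′)

module _ {A : Set} {n : ℕ} (A↔Fin : A ↔ Fin n) where
  open Inverse A↔Fin

  private
    to-injective : Injective _≡_ _≡_ to
    to-injective = Injection.injective (↔⇒↣ A↔Fin)

    from-injective : Injective _≡_ _≡_ from
    from-injective {x} {y} eq = begin
      x            ≡⟨ strictlyInverseˡ x ⟨
      to (from x)  ≡⟨ cong to eq ⟩
      to (from y)  ≡⟨ strictlyInverseˡ y ⟩
      y            ∎
      where open ≡-Reasoning

  ↔Fin-injective⇒strictlySurjective : (f : A → A) → Injective _≡_ _≡_ f →
    StrictlySurjective _≡_ f
  ↔Fin-injective⇒strictlySurjective f f-inj y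
    with Fin-injective⇒strictlySurjective (to ∘ f ∘ from) (from-injective ∘ f-inj ∘ to-injective) (to y)
  ... | i , to[f[from[i]]]≡to[y] = from i , to-injective to[f[from[i]]]≡to[y]

module SquareClasses {q : ℕ} (F : FiniteField q) where
  open FiniteField F
  open IsCommutativeRing isCommutativeRing
    using (*-comm; zeroʳ; *-identityˡ; *-identityʳ; +-identityʳ; distribʳ)
  open Jgraph F

  commutativeRing : CommutativeRing _ _
  commutativeRing = record { isCommutativeRing = isCommutativeRing }

  open RingProperties (CommutativeRing.ring commutativeRing) using (+-inverseˡ-unique; +-cancelʳ)
  open NaturalCoefficientsSolver (CommutativeRing.commutativeSemiring commutativeRing) (λ _ _ → nothing)
  open ≡-Reasoning

  _≟_ : DecidableEquality Carrier
  _≟_ = inj⇒≟ (↔⇒↣ enumeration)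

  ⁻¹-cancelˡ : ∀ {x} y → x ≢ 0# → x ⁻¹ * (x * y) ≡ y
  ⁻¹-cancelˡ {x} y x≢0 = begin
    x ⁻¹ * (x * y)  ≡⟨ solve 3 (λ x i y → i :* (x :* y) := (x :* i) :* y) refl x (x ⁻¹) y ⟩
    (x * x ⁻¹) * y  ≡⟨ cong (_* y) (⁻¹-inverse x x≢0) ⟩
    1# * y          ≡⟨ *-identityˡ y ⟩
    y               ∎

  *-nonzero : ∀ {x y} → x ≢ 0# → y ≢ 0# → x * y ≢ 0#
  *-nonzero {x} {y} x≢0 y≢0 xy≡0 = y≢0 (begin
    y               ≡⟨ ⁻¹-cancelˡ y x≢0 ⟨
    x ⁻¹ * (x * y)  ≡⟨ cong (x ⁻¹ *_) xy≡0 ⟩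
    x ⁻¹ * 0#       ≡⟨ zeroʳ (x ⁻¹) ⟩
    0#              ∎)

  *-nonzeroʳ : ∀ {x y} → x * y ≢ 0# → y ≢ 0#
  *-nonzeroʳ {x} xy≢0 y≡0 = xy≢0 (trans (cong (x *_) y≡0) (zeroʳ x))

  x+x≡two*x : ∀ x → x + x ≡ two * x
  x+x≡two*x x = begin
    x + x            ≡⟨ cong₂ _+_ (*-identityˡ x) (*-identityˡ x) ⟨
    1# * x + 1# * x  ≡⟨ distribʳ x 1# 1# ⟨
    two * x          ∎

  square-* : ∀ {x y} → IsSquare x → IsSquare y → IsSquare (x * y)
  square-* {x} {y} (s , s²≡x) (t , t²≡y) = s * t , (begin
    (s * t) * (s * t)  ≡⟨ solve 2 (λ s t → (s :* t) :* (s :* t) := (s :* s) :* (t :* t)) refl s t ⟩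
    (s * s) * (t * t)  ≡⟨ cong₂ _*_ s²≡x t²≡y ⟩
    x * y              ∎)

  square-⁻¹ : ∀ {x} → x ≢ 0# → IsSquare x → IsSquare (x ⁻¹)
  square-⁻¹ {x} x≢0 x-square = subst IsSquare x*x⁻²≡x⁻¹ (square-* x-square (x ⁻¹ , refl))
    where
    x*x⁻²≡x⁻¹ : x * (x ⁻¹ * x ⁻¹) ≡ x ⁻¹
    x*x⁻²≡x⁻¹ = begin
      x * (x ⁻¹ * x ⁻¹)  ≡⟨ solve 2 (λ x i → x :* (i :* i) := (x :* i) :* i) refl x (x ⁻¹) ⟩
      (x * x ⁻¹) * x ⁻¹  ≡⟨ cong (_* x ⁻¹) (⁻¹-inverse x x≢0) ⟩
      1# * x ⁻¹          ≡⟨ *-identityˡ (x ⁻¹) ⟩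
      x ⁻¹               ∎

  square-cancelˡ : ∀ {x y} → x ≢ 0# → IsSquare x → IsSquare (x * y) → IsSquare y
  square-cancelˡ {x} {y} x≢0 x-square xy-square =
    subst IsSquare (⁻¹-cancelˡ y x≢0) (square-* (square-⁻¹ x≢0 x-square) xy-square)

  infix 4 _∼_
  _∼_ : Carrier → Carrier → Set
  x ∼ y = x ≢ 0# × y ≢ 0# × IsSquare (x * y)

  ∼-refl : ∀ {x} → x ≢ 0# → x ∼ x
  ∼-refl {x} x≢0 = x≢0 , x≢0 , x , refl

  ∼-sym : ∀ {x y} → x ∼ y → y ∼ x
  ∼-sym {x} {y} (x≢0 , y≢0 , xy-square) = y≢0 , x≢0 , subst IsSquare (*-comm x y) xy-square

  ∼-trans : ∀ {x y z} → x ∼ y → y ∼ z → x ∼ z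
  ∼-trans {x} {y} {z} (x≢0 , y≢0 , xy-square) (_ , z≢0 , yz-square) =
    x≢0 , z≢0 , square-cancelˡ (*-nonzero y≢0 y≢0) (y , refl)
      (subst IsSquare (solve 3 (λ x y z → (x :* y) :* (y :* z) := (y :* y) :* (x :* z)) refl x y z)
        (square-* xy-square yz-square))

  ∼-*-cancelˡ : ∀ {x y z w} → x * z ∼ y * w → x ∼ y → z ∼ w
  ∼-*-cancelˡ {x} {y} {z} {w} (xz≢0 , yw≢0 , xzyw-square) (x≢0 , y≢0 , xy-square) =
    *-nonzeroʳ xz≢0 , *-nonzeroʳ yw≢0 , square-cancelˡ (*-nonzero x≢0 y≢0) xy-square
      (subst IsSquare (solve 4 (λ x y z w → (x :* z) :* (y :* w) := (x :* y) :* (z :* w)) refl x y z w)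
        xzyw-square)

  square-∼ : ∀ {x y} → x ∼ y → IsSquare x → IsSquare y
  square-∼ (x≢0 , _ , xy-square) x-square = square-cancelˡ x≢0 x-square xy-square

  Paired : Carrier → Carrier → Carrier → Carrier → Set
  Paired x y a c = (x ∼ a × y ∼ c) ⊎ (x ∼ c × y ∼ a)

  paired : ∀ {x y a c} → x * y ∼ a * c → x ∼ a ⊎ x ∼ c → Paired x y a c
  paired xy∼ac (inj₁ x∼a) = inj₁ (x∼a , ∼-*-cancelˡ xy∼ac x∼a)
  paired {x} {y} {a} {c} xy∼ac (inj₂ x∼c) =
    inj₂ (x∼c , ∼-*-cancelˡ (subst (x * y ∼_) (*-comm a c) xy∼ac) x∼c)

  paired-second : ∀ {x y a c} → Paired x y a c → y ∼ a ⊎ y ∼ c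
  paired-second (inj₁ (_ , y∼c)) = inj₂ y∼c
  paired-second (inj₂ (_ , y∼a)) = inj₁ y∼a

  paired-squares : ∀ {x y a c} → Paired x y a c → IsSquare x → IsSquare y → IsSquare a × IsSquare c
  paired-squares (inj₁ (x∼a , y∼c)) x-square y-square = square-∼ x∼a x-square , square-∼ y∼c y-square
  paired-squares (inj₂ (x∼c , y∼a)) x-square y-square = square-∼ y∼a y-square , square-∼ x∼c x-square

  paired-square : ∀ {x y a c} → Paired x y a c → IsSquare a ⊎ IsSquare c → IsSquare x ⊎ IsSquare y
  paired-square (inj₁ (x∼a , _))   (inj₁ a-square) = inj₁ (square-∼ (∼-sym x∼a) a-square)
  paired-square (inj₁ (_   , y∼c)) (inj₂ c-square) = inj₂ (square-∼ (∼-sym y∼c) c-square)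
  paired-square (inj₂ (_   , y∼a)) (inj₁ a-square) = inj₂ (square-∼ (∼-sym y∼a) a-square)
  paired-square (inj₂ (x∼c , _))   (inj₂ c-square) = inj₁ (square-∼ (∼-sym x∼c) c-square)

  first : Vertex → Carrier
  first ((a , _) , _) = a

  first-nonzero : ∀ w → first w ≢ 0#
  first-nonzero (_ , a≢0 , _) = a≢0

  square-vertex : ∀ w → IsSquare (first w) → SquareVertex w
  square-vertex (_ , a≢0 , _ , ab-square , _) a-square = a-square , square-cancelˡ a≢0 a-square ab-square

  module Characteristic2 (two≡0 : two ≡ 0#) where
    x+x≡0 : ∀ x → x + x ≡ 0#
    x+x≡0 x = begin
      x + x    ≡⟨ x+x≡two*x x ⟩
      two * x  ≡⟨ cong (_* x) two≡0 ⟩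
      0# * x   ≡⟨ *-comm 0# x ⟩
      x * 0#   ≡⟨ zeroʳ x ⟩
      0#       ∎

    x*x≡0⇒x≡0 : ∀ {x} → x * x ≡ 0# → x ≡ 0#
    x*x≡0⇒x≡0 {x} x²≡0 with x ≟ 0#
    ... | yes x≡0 = x≡0
    ... | no  x≢0 = ⊥-elim (*-nonzero x≢0 x≢0 x²≡0)

    square-injective : Injective _≡_ _≡_ (λ x → x * x)
    square-injective {x} {y} x²≡y² = +-cancelʳ y x y (trans x+y≡0 (sym (x+x≡0 y)))
      where
      x+y≡0 : x + y ≡ 0#
      x+y≡0 = x*x≡0⇒x≡0 (begin
        (x + y) * (x + y)                ≡⟨ solve 2 (λ x y → (x :+ y) :* (x :+ y) := x :* x :+ y :* y :+ (x :* y :+ x :* y)) refl x y ⟩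
        x * x + y * y + (x * y + x * y)  ≡⟨ cong₂ (λ s t → s + y * y + t) x²≡y² (x+x≡0 (x * y)) ⟩
        y * y + y * y + 0#               ≡⟨ +-identityʳ (y * y + y * y) ⟩
        y * y + y * y                    ≡⟨ x+x≡0 (y * y) ⟩
        0#                               ∎)

    every-square : ∀ x → IsSquare x
    every-square = ↔Fin-injective⇒strictlySurjective enumeration (λ x → x * x) square-injective

    every-square-vertex : ∀ w → SquareVertex w
    every-square-vertex ((a , b) , _) = every-square a , every-square b

  module OddCharacteristic (two≢0 : two ≢ 0#) where
    ½ : Carrier
    ½ = two ⁻¹

    ½≢0 : ½ ≢ 0#
    ½≢0 ½≡0 = 0≢1 (begin
      0#         ≡⟨ zeroʳ two ⟨
      two * 0#   ≡⟨ cong (two *_) ½≡0 ⟨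
      two * ½    ≡⟨ ⁻¹-inverse two two≢0 ⟩
      1#         ∎)

    [x+x]*½≡x : ∀ x → (x + x) * ½ ≡ x
    [x+x]*½≡x x = begin
      (x + x) * ½    ≡⟨ cong (_* ½) (x+x≡two*x x) ⟩
      (two * x) * ½  ≡⟨ solve 3 (λ t x h → (t :* x) :* h := x :* (t :* h)) refl two x ½ ⟩
      x * (two * ½)  ≡⟨ cong (x *_) (⁻¹-inverse two two≢0) ⟩
      x * 1#         ≡⟨ *-identityʳ x ⟩
      x              ∎

    a*mean≡square : ∀ {a b c d} → c ≡ (a + b) * ½ → d * d ≡ a * b →
      a * ((c + d) * ½) ≡ ((a + d) * ½) * ((a + d) * ½)
    a*mean≡square {a} {b} {c} {d} c≡mean d²≡ab = begin
      a * ((c + d) * ½)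
        ≡⟨ cong (λ m → a * ((m + d) * ½)) c≡mean ⟩
      a * (((a + b) * ½ + d) * ½)
        ≡⟨ solve 4 (λ a b d h → a :* (((a :+ b) :* h :+ d) :* h) := (a :* a :+ a :* b) :* h :* h :+ a :* d :* h) refl a b d ½ ⟩
      (a * a + a * b) * ½ * ½ + a * d * ½
        ≡⟨ cong₂ (λ s t → (a * a + s) * ½ * ½ + t) d²≡ab ([x+x]*½≡x (a * d * ½)) ⟨
      (a * a + d * d) * ½ * ½ + (a * d * ½ + a * d * ½) * ½
        ≡⟨ solve 3 (λ a d h → (a :* a :+ d :* d) :* h :* h :+ (a :* d :* h :+ a :* d :* h) :* h := ((a :+ d) :* h) :* ((a :+ d) :* h)) refl a d ½ ⟩
      ((a + d) * ½) * ((a + d) * ½)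
        ∎

    κ : Vertex → Carrier
    κ ((a , b) , _) = a * ((a + b) * ½)

    κ-nonzero : ∀ w → κ w ≢ 0#
    κ-nonzero ((a , b) , a≢0 , _ , _ , _ , a≢-b) =
      *-nonzero a≢0 (*-nonzero (a≢-b ∘ +-inverseˡ-unique a b) ½≢0)

    κ-edge : ∀ w x → Edge w x → κ w ≡ first w * first x
    κ-edge ((a , _) , _) _ (c≡mean , _) = cong (a *_) (sym c≡mean)

    κ-edge-square : ∀ w x → Edge w x → κ w ∼ κ x
    κ-edge-square w@((a , b) , _) x@((c , d) , _) (c≡mean , d²≡ab) =
      κ-nonzero w , κ-nonzero x , c * s , sym (begin
        (a * ((a + b) * ½)) * (c * ((c + d) * ½))
          ≡⟨ cong (λ m → (a * m) * (c * ((c + d) * ½))) c≡mean ⟨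
        (a * c) * (c * ((c + d) * ½))
          ≡⟨ solve 4 (λ a c d h → (a :* c) :* (c :* ((c :+ d) :* h)) := (c :* c) :* (a :* ((c :+ d) :* h))) refl a c d ½ ⟩
        (c * c) * (a * ((c + d) * ½))
          ≡⟨ cong ((c * c) *_) (a*mean≡square c≡mean d²≡ab) ⟩
        (c * c) * (s * s)
          ≡⟨ solve 2 (λ c s → (c :* c) :* (s :* s) := (c :* s) :* (c :* s)) refl c s ⟩
        (c * s) * (c * s)
          ∎)
      where
      s : Carrier
      s = (a + d) * ½

    κ-step : ∀ {w x} → SymClosure Edge w x → κ w ∼ κ x
    κ-step {w} {x} (fwd wx) = κ-edge-square w x wx
    κ-step {w} {x} (bwd xw) = ∼-sym (κ-edge-square x w xw)

    first*first-step : ∀ {w x} → SymClosure Edge w x → first w * first x ∼ κ w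
    first*first-step {w} {x} (fwd wx) = subst (_∼ κ w) (κ-edge w x wx) (∼-refl (κ-nonzero w))
    first*first-step {w} {x} (bwd xw) =
      subst (_∼ κ w) (trans (κ-edge x w xw) (*-comm (first x) (first w))) (κ-edge-square x w xw)

    module Component (u v : Vertex) (uv : Edge u v) where
      a c : Carrier
      a = first u
      c = first v

      Invariant : Vertex → Set
      Invariant w = κ w ∼ a * c × (first w ∼ a ⊎ first w ∼ c)

      invariant-step : ∀ {w x} → SymClosure Edge w x → Invariant w → Invariant x
      invariant-step wx (κw∼ac , first-w-class) =
        ∼-trans (∼-sym (κ-step wx)) κw∼ac ,
        paired-second (paired (∼-trans (first*first-step wx) κw∼ac) first-w-class)

      invariant : ∀ {w} → Connected u w → Invariant w
      invariant = go (subst (κ u ∼_) (κ-edge u v uv) (∼-refl (κ-nonzero u)) , inj₁ (∼-refl (first-nonzero u)))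
        where
        go : ∀ {w x} → Invariant w → Connected w x → Invariant x
        go inv-w ε          = inv-w
        go inv-w (wy ◅ y⇝x) = go (invariant-step wy inv-w) y⇝x

      edge-paired : ∀ {w} x → Connected u w → Edge w x → Paired (first w) (first x) a c
      edge-paired {w} x u⇝w wx =
        let κw∼ac , first-w-class = invariant u⇝w
        in paired (∼-trans (first*first-step {w} {x} (fwd wx)) κw∼ac) first-w-class

      squares-spread : SquareVertex u × SquareVertex v → ∀ w → Connected u w → SquareVertex w
      squares-spread (u-square , v-square) w u⇝w = square-vertex w
        ([ (λ w∼a → square-∼ (∼-sym w∼a) (proj₁ u-square))
         , (λ w∼c → square-∼ (∼-sym w∼c) (proj₁ v-square))
         ]′ (proj₂ (invariant u⇝w)))

      nonsquares-spread : NonSquareVertex u × NonSquareVertex v →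
        ∀ w → Connected u w → NonSquareVertex w
      nonsquares-spread (u-nonsquare , v-nonsquare) w u⇝w w-square with proj₂ (invariant u⇝w)
      ... | inj₁ w∼a = u-nonsquare (square-vertex u (square-∼ w∼a (proj₁ w-square)))
      ... | inj₂ w∼c = v-nonsquare (square-vertex v (square-∼ w∼c (proj₁ w-square)))

      Mixed : Set
      Mixed = (SquareVertex u × NonSquareVertex v) ⊎ (NonSquareVertex u × SquareVertex v)

      mixed⇒square : Mixed → IsSquare a ⊎ IsSquare c
      mixed⇒square (inj₁ (u-square , _)) = inj₁ (proj₁ u-square)
      mixed⇒square (inj₂ (_ , v-square)) = inj₂ (proj₁ v-square)

      mixed⇒nonsquare : Mixed → ¬ (IsSquare a × IsSquare c)
      mixed⇒nonsquare (inj₁ (_ , v-nonsquare)) (_ , c-square) = v-nonsquare (square-vertex v c-square)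
      mixed⇒nonsquare (inj₂ (u-nonsquare , _)) (a-square , _) = u-nonsquare (square-vertex u a-square)

      squares-alternate : Mixed → ∀ w x → Connected u w → Edge w x →
        ¬ (SquareVertex w × SquareVertex x) × ¬ (NonSquareVertex w × NonSquareVertex x)
      squares-alternate mixed w x u⇝w wx =
        (λ (w-square , x-square) → mixed⇒nonsquare mixed
           (paired-squares w-x-paired (proj₁ w-square) (proj₁ x-square))) ,
        (λ (w-nonsquare , x-nonsquare) →
           [ w-nonsquare ∘ square-vertex w , x-nonsquare ∘ square-vertex x ]′
             (paired-square w-x-paired (mixed⇒square mixed)))
        where
        w-x-paired : Paired (first w) (first x) a c
        w-x-paired = edge-paired x u⇝w wx

theorem3p9 : (q : ℕ) → Odd q → (F : FiniteField q) →
    let open Jgraph F in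
    (u v : Vertex) → Edge u v →
      ((SquareVertex u × SquareVertex v) →
         ∀ w → Connected u w → SquareVertex w)
      × ((NonSquareVertex u × NonSquareVertex v) →
         ∀ w → Connected u w → NonSquareVertex w)
      × (((SquareVertex u × NonSquareVertex v) ⊎ (NonSquareVertex u × SquareVertex v)) →
         ∀ w x → Connected u w → Edge w x →
           ¬ (SquareVertex w × SquareVertex x) × ¬ (NonSquareVertex w × NonSquareVertex x))
theorem3p9 q _ F u v uv with SquareClasses._≟_ F (Jgraph.two F) (FiniteField.0# F)
... | yes two≡0 =
  (λ _ w _ → square w) ,
  (λ (u-nonsquare , _) _ _ → ⊥-elim (u-nonsquare (square u))) ,
  [ (λ (_ , v-nonsquare) → ⊥-elim (v-nonsquare (square v)))
  , (λ (u-nonsquare , _) → ⊥-elim (u-nonsquare (square u)))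
  ]′
  where open SquareClasses.Characteristic2 F two≡0 renaming (every-square-vertex to square)
... | no two≢0 = squares-spread , nonsquares-spread , squares-alternate
  where open SquareClasses.OddCharacteristic.Component F two≢0 u v uv
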